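{- Let $k\ge 2$ and $\alpha\ge 1$ be integers, and let $A$ be the $k^{\alpha}\times\alpha k$ benchmark matrix with induced clusterings $\mathcal{C}^a=\{C_1^a,\dots,C_k^a\}$, $a\in\{0,\dots,\alpha-1\}$, as defined in the context. For every $a\in\{0,\dots,\alpha-1\}$ and $j\in\{1,\dots,k\}$, $$\sum_{p\in C_j^a}\|p-\mu(C_j^a)\|_2^2=(\alpha-1)\,k^{\alpha-2}\,(k-1),$$ where $\mu(C_j^a)=\frac{1}{|C_j^a|}\sum_{p\in C_j^a}p$.
   Context: Benchmark construction. Fix integers $k\ge 2$, $\alpha\ge 1$, and put $n=k^{\alpha}$, $d=\alpha k$. Let $\mathbb{1}_m$ be the all-ones vector of length $m$, and let $\otimes$ be the Kronecker product, so that for a vector $v$ of length $m$, $v\otimes \mathbb{1}_k$ is the vector of length $mk$ obtained by replacing each entry $v_j$ by the block $v_j\mathbb{1}_k$, and $\mathbb{1}_r\otimes v$ is $v$ repeated $r$ times. For $i\in\{1,\dots,k\}$ let $v_i^1\in\mathbb{R}^k$ have entries $(v_i^1)_j=-\frac1k$ for $j\ne i$ and $(v_i^1)_i=\frac{k-1}{k}$; for $\ell\ge 2$ let $v_i^{\ell}=v_i^{\ell-1}\otimes\mathbb{1}_k\in\mathbb{R}^{k^{\ell}}$. The benchmark is the $n\times d$ matrix $A$ whose column $t=a k+b$, for $a\in\{0,\dots,\alpha-1\}$ and $b\in\{1,\dots,k\}$, equals $\mathbb{1}_{k^{\alpha-a-1}}\otimes v_b^{a+1}$. The rows $A_1,\dots,A_n$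 are the input points in $\mathbb{R}^d$. For each $a$ define the clustering $\mathcal{C}^a=\{C_1^a,\dots,C_k^a\}$ of the rows by: $A_i\in C_j^a$ iff $A_{i,ak+j}>0$. -}

module Defs where

open import Data.Nat as ℕ using (ℕ; zero; suc; _∸_; _^_; _≡ᵇ_)
open import Data.Bool using (if_then_else_)
open import Data.Integer using (+_)
open import Data.List using (List; []; _∷_; map; concatMap; replicate; upTo; filter; length; zipWith; foldr)
open import Data.Rational using (ℚ; 0ℚ; 1ℚ; _+_; _-_; _*_; _/_; _<?_)

ℕ→ℚ : ℕ → ℚ
ℕ→ℚ n = + n / 1

-- reciprocal of a natural number (only used for nonzero arguments; 1/0 := 0)
inv : ℕ → ℚ
inv zero    = 0ℚ
inv (suc n) = + 1 / suc n

-- Kronecker product of vectors (as lists): each entry x of v becomes the block x·w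
_⊗_ : List ℚ → List ℚ → List ℚ
v ⊗ w = concatMap (λ x → map (x *_) w) v

𝟙 : ℕ → List ℚ
𝟙 m = replicate m 1ℚ

-- v_i^1 ∈ ℝ^k (i 1-based): entry j is (k-1)/k if j = i, and -1/k otherwise
v1 : (k i : ℕ) → List ℚ
v1 k i = map (λ j → (if (suc j ≡ᵇ i) then 1ℚ else 0ℚ) - inv k) (upTo k)

-- v_i^ℓ for ℓ ≥ 1, with v_i^ℓ = v_i^{ℓ-1} ⊗ 𝟙_k ; argument ℓ' stands for ℓ = ℓ' + 1
vℓ : (k i ℓ' : ℕ) → List ℚ
vℓ k i zero     = v1 k i
vℓ k i (suc ℓ') = vℓ k i ℓ' ⊗ 𝟙 k

-- column t = a k + b (a ∈ {0..α-1}, b ∈ {1..k}) of the benchmark: 𝟙_{k^{α-a-1}} ⊗ v_b^{a+1}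
column : (k α a b : ℕ) → List ℚ
column k α a b = 𝟙 (k ^ (α ∸ a ∸ 1)) ⊗ vℓ k b a

columns : (k α : ℕ) → List (List ℚ)
columns k α = concatMap (λ a → map (λ b → column k α a (suc b)) (upTo k)) (upTo α)

nth : List ℚ → ℕ → ℚ
nth []       _       = 0ℚ
nth (x ∷ xs) zero    = x
nth (x ∷ xs) (suc i) = nth xs i

rows : (k α : ℕ) → List (List ℚ)
rows k α = map (λ i → map (λ col → nth col i) (columns k α)) (upTo (k ^ α))

-- cluster C_j^a (j 1-based): rows p with A_{p, ak+j} > 0 ; 0-based column index a k + (j - 1)
cluster : (k α a j : ℕ) → List (List ℚ)
cluster k α a j = filter (λ p → 0ℚ <? nth p (a ℕ.* k ℕ.+ (j ∸ 1))) (rows k α)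

_⊕_ : List ℚ → List ℚ → List ℚ
_⊕_ = zipWith _+_

_⊖_ : List ℚ → List ℚ → List ℚ
_⊖_ = zipWith _-_

scale : ℚ → List ℚ → List ℚ
scale c = map (c *_)

‖_‖² : List ℚ → ℚ
‖ v ‖² = foldr (λ x s → x * x + s) 0ℚ v

vsum : ℕ → List (List ℚ) → List ℚ
vsum d = foldr _⊕_ (replicate d 0ℚ)

μ : ℕ → List (List ℚ) → List ℚ
μ d C = scale (inv (length C)) (vsum d C)

cost : ℕ → List (List ℚ) → ℚ
cost d C = foldr (λ p s → ‖ p ⊖ μ d C ‖² + s) 0ℚ C

{-# OPTIONS --safe #-}
-- Row i of the benchmark (i < k^α) has in column (a, b) the entry [dₐ(i) = b] − 1/k, where
-- dₐ(i) is the a-th base-k digit of i, counted from the least significant one. So Cⱼᵃ consists of the rows whose a-th digit is j, and a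
-- sum over Cⱼᵃ is a sum over all i < k^α weighted by [dₐ(i) = j]. The digits of i range
-- independently over {0, …, k−1}, so such sums factor: |Cⱼᵃ| = k^(α−1); the centroid coincides
-- with every point of the cluster on the k columns of block a and vanishes on all other blocks;
-- and on each of the (α−1)k columns outside block a the squared deviations add up to
-- k^(α−2) · Σₓ ([x = b] − 1/k)² = k^(α−2) (k−1)/k.
module Submission where

open import Defs
open import Data.Nat using (ℕ; _≤_; _<_; _∸_; _^_; _*_)
open import Relation.Binary.PropositionalEquality using (_≡_)

open import Data.Bool using (Bool; true; false; if_then_else_)
open import Data.Empty using (⊥-elim)
import Data.Integer as ℤ
import Data.Integer.Properties as ℤ
open import Data.List using (List; []; _∷_; _++_; foldr; map; concatMap; applyUpTo; upTo; filter; length; replicate)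
open import Data.List.Properties
  using (length-replicate; length-map; length-++; length-upTo; length-applyUpTo; map-cong; map-upTo;
         map-applyUpTo; map-concatMap; concatMap-cong)
open import Data.List.Relation.Unary.All using (All; []; _∷_)
open import Data.List.Relation.Unary.All.Properties using (filter⁺; map⁺; applyUpTo⁺₂)
open import Data.Nat as ℕ using (zero; suc; _≡ᵇ_; z≤n; s≤s; NonZero)
open import Data.Nat.Coprimality using (1-coprimeTo) renaming (sym to coprime-sym)
open import Data.Nat.Divisibility using (n∣m*n)
open import Data.Nat.DivMod
  using (_/_; _%_; m%n<n; m≡m%n+[m/n]*n; m<n*o⇒m/o<n; m%[n*o]/o≡m/o%n; n/1≡n; m/n/o≡m/[n*o]; %-remove-+ʳ;
         m<n⇒m%n≡m; +-distrib-/-∣ʳ; m<n⇒m/n≡0; m*n/n≡m)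
import Data.Nat.Properties as ℕ
open import Algebra.Properties.CommutativeSemigroup ℕ.+-commutativeSemigroup
  using () renaming (x∙yz≈y∙xz to +-left-comm)
-- Multiplication on ℚ is written · because * in the statement is multiplication on ℕ.
open import Data.Rational as ℚ using (ℚ; 0ℚ; 1ℚ; mkℚ; _+_; _-_; _<?_; Positive) renaming (_*_ to _·_)
open import Data.Rational.Properties
  using (+-*-commutativeRing; _≟_; normalize-coprime; +-identityˡ; +-identityʳ; +-assoc; +-inverseʳ;
         *-identityˡ; *-identityʳ; *-zeroˡ; *-zeroʳ; *-comm; *-assoc; *-distribˡ-+; *-distribʳ-+; *-inverseˡ;
         <-asym; positive⁻¹; negative⁻¹; pos*pos⇒pos; neg-pos)
open import Level using (0ℓ)
open import Relation.Binary.PropositionalEquality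
  using (_≢_; refl; sym; cong; cong₂; trans; subst; module ≡-Reasoning)
open import Relation.Nullary using (does)
open import Relation.Nullary.Decidable using (dec⇒maybe; dec-true; dec-false)
open import Relation.Unary using (Pred; Decidable)
import Tactic.RingSolver.Core.AlmostCommutativeRing as ACR
open import Tactic.RingSolver using (solve-∀)

open ≡-Reasoning

ℚ-ring : ACR.AlmostCommutativeRing 0ℓ 0ℓ
ℚ-ring = ACR.fromCommutativeRing +-*-commutativeRing (λ x → dec⇒maybe (0ℚ ≟ x))

*-left-comm : ∀ x y z → x · (y · z) ≡ y · (x · z)
*-left-comm = solve-∀ ℚ-ring

ℕ→ℚ-mkℚ : ∀ n → ℕ→ℚ n ≡ mkℚ (ℤ.+ n) 0 (coprime-sym (1-coprimeTo n))
ℕ→ℚ-mkℚ n = normalize-coprime (coprime-sym (1-coprimeTo n))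

ℕ→ℚ-suc : ∀ n → ℕ→ℚ (suc n) ≡ 1ℚ + ℕ→ℚ n
ℕ→ℚ-suc n rewrite ℕ→ℚ-mkℚ n = cong (ℚ._/ 1) (cong (ℤ._+_ (ℤ.+ 1)) (sym (ℤ.*-identityʳ (ℤ.+ n))))

ℕ→ℚ-+ : ∀ m n → ℕ→ℚ (m ℕ.+ n) ≡ ℕ→ℚ m + ℕ→ℚ n
ℕ→ℚ-+ zero    n = sym (+-identityˡ (ℕ→ℚ n))
ℕ→ℚ-+ (suc m) n = begin
  ℕ→ℚ (suc (m ℕ.+ n))   ≡⟨ ℕ→ℚ-suc (m ℕ.+ n) ⟩
  1ℚ + ℕ→ℚ (m ℕ.+ n)    ≡⟨ cong (1ℚ +_) (ℕ→ℚ-+ m n) ⟩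
  1ℚ + (ℕ→ℚ m + ℕ→ℚ n)  ≡⟨ +-assoc 1ℚ (ℕ→ℚ m) (ℕ→ℚ n) ⟨
  (1ℚ + ℕ→ℚ m) + ℕ→ℚ n  ≡⟨ cong (_+ ℕ→ℚ n) (ℕ→ℚ-suc m) ⟨
  ℕ→ℚ (suc m) + ℕ→ℚ n   ∎

ℕ→ℚ-* : ∀ m n → ℕ→ℚ (m * n) ≡ ℕ→ℚ m · ℕ→ℚ n
ℕ→ℚ-* zero    n = sym (*-zeroˡ (ℕ→ℚ n))
ℕ→ℚ-* (suc m) n = begin
  ℕ→ℚ (n ℕ.+ m * n)            ≡⟨ ℕ→ℚ-+ n (m * n) ⟩
  ℕ→ℚ n + ℕ→ℚ (m * n)          ≡⟨ cong (ℕ→ℚ n +_) (ℕ→ℚ-* m n) ⟩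
  ℕ→ℚ n + ℕ→ℚ m · ℕ→ℚ n        ≡⟨ cong (_+ ℕ→ℚ m · ℕ→ℚ n) (*-identityˡ (ℕ→ℚ n)) ⟨
  1ℚ · ℕ→ℚ n + ℕ→ℚ m · ℕ→ℚ n   ≡⟨ *-distribʳ-+ (ℕ→ℚ n) 1ℚ (ℕ→ℚ m) ⟨
  (1ℚ + ℕ→ℚ m) · ℕ→ℚ n         ≡⟨ cong (_· ℕ→ℚ n) (ℕ→ℚ-suc m) ⟨
  ℕ→ℚ (suc m) · ℕ→ℚ n          ∎

ℕ→ℚ-injective : ∀ {m n} → ℕ→ℚ m ≡ ℕ→ℚ n → m ≡ n
ℕ→ℚ-injective {m} {n} eq =
  ℤ.+-injective (cong ℚ.↥_ (trans (sym (ℕ→ℚ-mkℚ m)) (trans eq (ℕ→ℚ-mkℚ n))))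

ℕ→ℚ-positive : ∀ n .{{_ : NonZero n}} → Positive (ℕ→ℚ n)
ℕ→ℚ-positive (suc n) rewrite ℕ→ℚ-mkℚ (suc n) = _

inv-mkℚ : ∀ n → inv (suc n) ≡ mkℚ (ℤ.+ 1) n (1-coprimeTo (suc n))
inv-mkℚ n = normalize-coprime (1-coprimeTo (suc n))

inv-inverseˡ : ∀ n .{{_ : NonZero n}} → inv n · ℕ→ℚ n ≡ 1ℚ
inv-inverseˡ (suc n) rewrite inv-mkℚ n | ℕ→ℚ-mkℚ (suc n) =
  *-inverseˡ (mkℚ (ℤ.+ suc n) 0 (coprime-sym (1-coprimeTo (suc n))))

inv-positive : ∀ n .{{_ : NonZero n}} → Positive (inv n)
inv-positive (suc n) rewrite inv-mkℚ n = _

1-inv-suc : ∀ m → 1ℚ - inv (suc m) ≡ ℕ→ℚ m · inv (suc m)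
1-inv-suc m = begin
  1ℚ - u                ≡⟨ cong (_- u) (inv-inverseˡ (suc m)) ⟨
  u · ℕ→ℚ (suc m) - u   ≡⟨ cong (λ x → u · x - u) (ℕ→ℚ-suc m) ⟩
  u · (1ℚ + ℕ→ℚ m) - u  ≡⟨ cancel u (ℕ→ℚ m) ⟩
  ℕ→ℚ m · u             ∎
  where
  u = inv (suc m)
  cancel : ∀ u x → u · (1ℚ + x) - u ≡ x · u
  cancel = solve-∀ ℚ-ring

infix 8 _²
_² : ℚ → ℚ
x ² = x · x

-- Finite sums

infix 5 ∑<
∑< : ℕ → (ℕ → ℚ) → ℚ
∑< zero    f = 0ℚ
∑< (suc n) f = f 0 + ∑< n (λ i → f (suc i))
syntax ∑< n (λ i → e) = ∑[ i < n ] e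

∑-cong : ∀ n {f g : ℕ → ℚ} → (∀ i → i < n → f i ≡ g i) → ∑[ i < n ] f i ≡ ∑[ i < n ] g i
∑-cong zero    f≗g = refl
∑-cong (suc n) f≗g = cong₂ _+_ (f≗g 0 (s≤s z≤n)) (∑-cong n (λ i i<n → f≗g (suc i) (s≤s i<n)))

∑-distrib-+ : ∀ n (f g : ℕ → ℚ) → ∑[ i < n ] (f i + g i) ≡ (∑[ i < n ] f i) + (∑[ i < n ] g i)
∑-distrib-+ zero    f g = refl
∑-distrib-+ (suc n) f g = trans (cong (f 0 + g 0 +_) (∑-distrib-+ n (λ i → f (suc i)) (λ i → g (suc i))))
                                (interchange (f 0) (g 0) _ _)
  where
  interchange : ∀ a b c d → (a + b) + (c + d) ≡ (a + c) + (b + d)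
  interchange = solve-∀ ℚ-ring

*-distribˡ-∑ : ∀ n c (f : ℕ → ℚ) → c · (∑[ i < n ] f i) ≡ ∑[ i < n ] (c · f i)
*-distribˡ-∑ zero    c f = *-zeroʳ c
*-distribˡ-∑ (suc n) c f = trans (*-distribˡ-+ c (f 0) _) (cong (c · f 0 +_) (*-distribˡ-∑ n c (λ i → f (suc i))))

*-distribʳ-∑ : ∀ n c (f : ℕ → ℚ) → (∑[ i < n ] f i) · c ≡ ∑[ i < n ] (f i · c)
*-distribʳ-∑ n c f = trans (*-comm _ c) (trans (*-distribˡ-∑ n c f) (∑-cong n (λ i _ → *-comm c (f i))))

∑-const : ∀ n c → ∑[ i < n ] c ≡ ℕ→ℚ n · c
∑-const zero    c = sym (*-zeroˡ c)
∑-const (suc n) c = begin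
  c + (∑[ i < n ] c)  ≡⟨ cong (c +_) (∑-const n c) ⟩
  c + ℕ→ℚ n · c       ≡⟨ cong (_+ ℕ→ℚ n · c) (*-identityˡ c) ⟨
  1ℚ · c + ℕ→ℚ n · c  ≡⟨ *-distribʳ-+ c 1ℚ (ℕ→ℚ n) ⟨
  (1ℚ + ℕ→ℚ n) · c    ≡⟨ cong (_· c) (ℕ→ℚ-suc n) ⟨
  ℕ→ℚ (suc n) · c     ∎

∑-1 : ∀ n → ∑[ i < n ] 1ℚ ≡ ℕ→ℚ n
∑-1 n = trans (∑-const n 1ℚ) (*-identityʳ (ℕ→ℚ n))

∑-split : ∀ m n (f : ℕ → ℚ) → ∑[ i < m ℕ.+ n ] f i ≡ (∑[ i < m ] f i) + (∑[ i < n ] f (m ℕ.+ i))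
∑-split zero    n f = sym (+-identityˡ _)
∑-split (suc m) n f = trans (cong (f 0 +_) (∑-split m n (λ i → f (suc i)))) (sym (+-assoc (f 0) _ _))

∑-blocks : ∀ n m (f : ℕ → ℚ) → ∑[ i < n * m ] f i ≡ ∑[ q < n ] ∑[ r < m ] f (r ℕ.+ q * m)
∑-blocks zero    m f = refl
∑-blocks (suc n) m f = begin
  ∑[ i < m ℕ.+ n * m ] f i
    ≡⟨ ∑-split m (n * m) f ⟩
  (∑[ r < m ] f r) + (∑[ i < n * m ] f (m ℕ.+ i))
    ≡⟨ cong₂ _+_ (∑-cong m (λ r _ → cong f (sym (ℕ.+-identityʳ r))))
                 (trans (∑-blocks n m (λ i → f (m ℕ.+ i)))
                        (∑-cong n (λ q _ → ∑-cong m (λ r _ → cong f (+-left-comm m r (q * m)))))) ⟩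
  (∑[ r < m ] f (r ℕ.+ 0)) + (∑[ q < n ] ∑[ r < m ] f (r ℕ.+ (m ℕ.+ q * m)))
    ∎

∑-const-except : ∀ n a c (f : ℕ → ℚ) → a < n → (∀ i → i < n → i ≢ a → f i ≡ c) →
                 ∑[ i < n ] f i ≡ f a + ℕ→ℚ (n ∸ 1) · c
∑-const-except (suc n) zero c f _ f≡c =
  cong (f 0 +_) (trans (∑-cong n (λ i i<n → f≡c (suc i) (s≤s i<n) λ ())) (∑-const n c))
∑-const-except (suc (suc n)) (suc a) c f (s≤s a<n) f≡c = begin
  f 0 + (∑[ i < suc n ] f (suc i))
    ≡⟨ cong₂ _+_ (f≡c 0 (s≤s z≤n) λ ())
                 (∑-const-except (suc n) a c (λ i → f (suc i)) a<n
                    (λ i i<n i≢a → f≡c (suc i) (s≤s i<n) (λ eq → i≢a (ℕ.suc-injective eq)))) ⟩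
  c + (f (suc a) + ℕ→ℚ n · c)
    ≡⟨ rearrange c (f (suc a)) (ℕ→ℚ n) ⟩
  f (suc a) + (1ℚ + ℕ→ℚ n) · c
    ≡⟨ cong (λ x → f (suc a) + x · c) (ℕ→ℚ-suc n) ⟨
  f (suc a) + ℕ→ℚ (suc n) · c
    ∎
  where
  rearrange : ∀ c x y → c + (x + y · c) ≡ x + (1ℚ + y) · c
  rearrange = solve-∀ ℚ-ring

δ : ℕ → ℕ → ℚ
δ x j = if x ≡ᵇ j then 1ℚ else 0ℚ

-- does (x ℕ.≟ j) reduces to x ≡ᵇ j, so δ can be evaluated through the decision procedure.
δ-diag : ∀ x → δ x x ≡ 1ℚ
δ-diag x = cong (λ b → if b then 1ℚ else 0ℚ) (dec-true (x ℕ.≟ x) refl)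

δ-off : ∀ {x j} → x ≢ j → δ x j ≡ 0ℚ
δ-off {x} {j} x≢j = cong (λ b → if b then 1ℚ else 0ℚ) (dec-false (x ℕ.≟ j) x≢j)

if-then-else-0 : ∀ b x → (if b then x else 0ℚ) ≡ (if b then 1ℚ else 0ℚ) · x
if-then-else-0 true  x = sym (*-identityˡ x)
if-then-else-0 false x = sym (*-zeroˡ x)

∑-δ : ∀ n j (f : ℕ → ℚ) → j < n → ∑[ x < n ] (δ x j · f x) ≡ f j
∑-δ n j f j<n = begin
  ∑[ x < n ] (δ x j · f x)
    ≡⟨ ∑-const-except n j 0ℚ _ j<n (λ x _ x≢j → trans (cong (_· f x) (δ-off x≢j)) (*-zeroˡ (f x))) ⟩
  δ j j · f j + ℕ→ℚ (n ∸ 1) · 0ℚ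
    ≡⟨ cong₂ _+_ (trans (cong (_· f j) (δ-diag j)) (*-identityˡ (f j))) (*-zeroʳ (ℕ→ℚ (n ∸ 1))) ⟩
  f j + 0ℚ
    ≡⟨ +-identityʳ (f j) ⟩
  f j
    ∎

∑-entry : ∀ {k b} → b < k → ∑[ x < k ] (δ x b - inv k) ≡ 0ℚ
∑-entry {suc m} {b} b<k = begin
  ∑[ x < suc m ] (δ x b - u)
    ≡⟨ ∑-const-except (suc m) b (0ℚ - u) _ b<k (λ x _ x≢b → cong (_- u) (δ-off x≢b)) ⟩
  (δ b b - u) + ℕ→ℚ m · (0ℚ - u)  ≡⟨ cong (λ y → (y - u) + ℕ→ℚ m · (0ℚ - u)) (δ-diag b) ⟩
  (1ℚ - u) + ℕ→ℚ m · (0ℚ - u)     ≡⟨ collect u (ℕ→ℚ m) ⟩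
  1ℚ - u · (1ℚ + ℕ→ℚ m)           ≡⟨ cong (λ y → 1ℚ - u · y) (ℕ→ℚ-suc m) ⟨
  1ℚ - u · ℕ→ℚ (suc m)            ≡⟨ cong (1ℚ -_) (inv-inverseˡ (suc m)) ⟩
  1ℚ - 1ℚ                         ≡⟨ +-inverseʳ 1ℚ ⟩
  0ℚ                              ∎
  where
  u = inv (suc m)
  collect : ∀ u x → (1ℚ - u) + x · (0ℚ - u) ≡ 1ℚ - u · (1ℚ + x)
  collect = solve-∀ ℚ-ring

∑-entry² : ∀ {k b} → b < k → ∑[ x < k ] (δ x b - inv k) ² ≡ ℕ→ℚ (k ∸ 1) · inv k
∑-entry² {suc m} {b} b<k = begin
  ∑[ x < suc m ] (δ x b - u) ²
    ≡⟨ ∑-const-except (suc m) b ((0ℚ - u) ²) _ b<k (λ x _ x≢b → cong (λ y → (y - u) ²) (δ-off x≢b)) ⟩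
  (δ b b - u) ² + ℕ→ℚ m · (0ℚ - u) ²
    ≡⟨ cong (λ y → (y - u) ² + ℕ→ℚ m · (0ℚ - u) ²) (δ-diag b) ⟩
  (1ℚ - u) ² + ℕ→ℚ m · (0ℚ - u) ²    ≡⟨ expand u (ℕ→ℚ m) ⟩
  1ℚ - u - u + u · (1ℚ + ℕ→ℚ m) · u  ≡⟨ cong (λ y → 1ℚ - u - u + u · y · u) (ℕ→ℚ-suc m) ⟨
  1ℚ - u - u + u · ℕ→ℚ (suc m) · u   ≡⟨ cong (λ y → 1ℚ - u - u + y · u) (inv-inverseˡ (suc m)) ⟩
  1ℚ - u - u + 1ℚ · u                ≡⟨ simplify u ⟩
  1ℚ - u                             ≡⟨ 1-inv-suc m ⟩
  ℕ→ℚ m · u                          ∎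
  where
  u = inv (suc m)
  expand : ∀ u x → (1ℚ - u) · (1ℚ - u) + x · ((0ℚ - u) · (0ℚ - u)) ≡ 1ℚ - u - u + u · (1ℚ + x) · u
  expand = solve-∀ ℚ-ring
  simplify : ∀ u → 1ℚ - u - u + 1ℚ · u ≡ 1ℚ - u
  simplify = solve-∀ ℚ-ring

entry-sign : ∀ k → 1 < k → ∀ b → does (0ℚ <? ((if b then 1ℚ else 0ℚ) - inv k)) ≡ b
entry-sign (suc (suc m)) _ true  = dec-true (0ℚ <? (1ℚ - u)) 0<1-u
  where
  u = inv (2 ℕ.+ m)
  instance _ = ℕ→ℚ-positive (suc m)
           _ = inv-positive (2 ℕ.+ m)
  0<1-u : 0ℚ ℚ.< 1ℚ - u
  0<1-u = subst (0ℚ ℚ.<_) (sym (1-inv-suc (suc m))) (positive⁻¹ (ℕ→ℚ (suc m) · u) {{pos*pos⇒pos (ℕ→ℚ (suc m)) u}})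
entry-sign (suc (suc m)) _ false = dec-false (0ℚ <? (0ℚ - u)) (λ 0<-u → <-asym {0ℚ} {0ℚ - u} 0<-u -u<0)
  where
  u = inv (2 ℕ.+ m)
  -u<0 : 0ℚ - u ℚ.< 0ℚ
  -u<0 = subst (ℚ._< 0ℚ) (sym (+-identityˡ (ℚ.- u)))
               (negative⁻¹ (ℚ.- u) {{neg-pos {u} (inv-positive (2 ℕ.+ m))}})
entry-sign (suc zero) (s≤s ()) b

infix 5 ∑∈
∑∈ : {A : Set} → List A → (A → ℚ) → ℚ
∑∈ xs f = foldr (λ x s → f x + s) 0ℚ xs
syntax ∑∈ xs (λ x → e) = ∑[ x ∈ xs ] e

∑∈-applyUpTo : ∀ {A : Set} (f : ℕ → A) n (g : A → ℚ) → ∑[ x ∈ applyUpTo f n ] g x ≡ ∑[ i < n ] g (f i)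
∑∈-applyUpTo f zero    g = refl
∑∈-applyUpTo f (suc n) g = cong (g (f 0) +_) (∑∈-applyUpTo (λ i → f (suc i)) n g)

∑∈-filter : ∀ {A : Set} {P : Pred A 0ℓ} (P? : Decidable P) xs (g : A → ℚ) →
            ∑[ x ∈ filter P? xs ] g x ≡ ∑[ x ∈ xs ] (if does (P? x) then g x else 0ℚ)
∑∈-filter P? []       g = refl
∑∈-filter P? (x ∷ xs) g with does (P? x)
... | true  = cong (g x +_) (∑∈-filter P? xs g)
... | false = trans (∑∈-filter P? xs g) (sym (+-identityˡ _))

∑∈-cong : ∀ {A : Set} {P : A → Set} {xs} {f g : A → ℚ} → All P xs → (∀ x → P x → f x ≡ g x) →
          ∑[ x ∈ xs ] f x ≡ ∑[ x ∈ xs ] g x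
∑∈-cong []         f≗g = refl
∑∈-cong (px ∷ pxs) f≗g = cong₂ _+_ (f≗g _ px) (∑∈-cong pxs f≗g)

∑∈-∑-comm : ∀ {A : Set} (xs : List A) d (F : A → ℕ → ℚ) →
            ∑[ x ∈ xs ] ∑[ c < d ] F x c ≡ ∑[ c < d ] ∑[ x ∈ xs ] F x c
∑∈-∑-comm []       d F = sym (trans (∑-const d 0ℚ) (*-zeroʳ (ℕ→ℚ d)))
∑∈-∑-comm (x ∷ xs) d F = trans (cong (∑< d (F x) +_) (∑∈-∑-comm xs d F))
                               (sym (∑-distrib-+ d (F x) (λ c → ∑[ y ∈ xs ] F y c)))

length-∑∈ : ∀ {A : Set} (xs : List A) → ℕ→ℚ (length xs) ≡ ∑[ x ∈ xs ] 1ℚ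
length-∑∈ []       = refl
length-∑∈ (x ∷ xs) = trans (ℕ→ℚ-suc (length xs)) (cong (1ℚ +_) (length-∑∈ xs))

nth-replicate-0ℚ : ∀ d c → nth (replicate d 0ℚ) c ≡ 0ℚ
nth-replicate-0ℚ zero    c       = refl
nth-replicate-0ℚ (suc d) zero    = refl
nth-replicate-0ℚ (suc d) (suc c) = nth-replicate-0ℚ d c

nth-𝟙 : ∀ {n x} → x < n → nth (𝟙 n) x ≡ 1ℚ
nth-𝟙 {suc n} {zero}  _         = refl
nth-𝟙 {suc n} {suc x} (s≤s x<n) = nth-𝟙 x<n

nth-applyUpTo : ∀ (f : ℕ → ℚ) {n x} → x < n → nth (applyUpTo f n) x ≡ f x
nth-applyUpTo f {suc n} {zero}  _         = refl
nth-applyUpTo f {suc n} {suc x} (s≤s x<n) = nth-applyUpTo (λ i → f (suc i)) x<n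

nth-scale : ∀ a w r → nth (scale a w) r ≡ a · nth w r
nth-scale a []      r       = sym (*-zeroʳ a)
nth-scale a (x ∷ w) zero    = refl
nth-scale a (x ∷ w) (suc r) = nth-scale a w r

nth-map-·ʳ : ∀ u c q → nth (map (_· c) u) q ≡ nth u q · c
nth-map-·ʳ []      c q       = sym (*-zeroˡ c)
nth-map-·ʳ (x ∷ u) c zero    = refl
nth-map-·ʳ (x ∷ u) c (suc q) = nth-map-·ʳ u c q

nth-++ˡ : ∀ xs ys {i} → i < length xs → nth (xs ++ ys) i ≡ nth xs i
nth-++ˡ (x ∷ xs) ys {zero}  _         = refl
nth-++ˡ (x ∷ xs) ys {suc i} (s≤s i<n) = nth-++ˡ xs ys i<n

nth-++ʳ : ∀ xs ys i → nth (xs ++ ys) (length xs ℕ.+ i) ≡ nth ys i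
nth-++ʳ []       ys i = refl
nth-++ʳ (x ∷ xs) ys i = nth-++ʳ xs ys i

module _ {A : Set} (B : A → List ℚ) {m : ℕ} (length-B : ∀ x → length (B x) ≡ m) where

  length-concatMap : ∀ u → length (concatMap B u) ≡ length u * m
  length-concatMap []      = refl
  length-concatMap (x ∷ u) = trans (length-++ (B x)) (cong₂ ℕ._+_ (length-B x) (length-concatMap u))

  nth-concatMap : ∀ u q {r} → r < m → nth (concatMap B u) (r ℕ.+ q * m) ≡ nth (map (λ x → nth (B x) r) u) q
  nth-concatMap []      q       r<m = refl
  nth-concatMap (x ∷ u) zero    {r} r<m = begin
    nth (B x ++ concatMap B u) (r ℕ.+ 0)  ≡⟨ cong (nth (B x ++ concatMap B u)) (ℕ.+-identityʳ r) ⟩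
    nth (B x ++ concatMap B u) r          ≡⟨ nth-++ˡ (B x) (concatMap B u) (subst (r <_) (sym (length-B x)) r<m) ⟩
    nth (B x) r                           ∎
  nth-concatMap (x ∷ u) (suc q) {r} r<m = begin
    nth (B x ++ concatMap B u) (r ℕ.+ (m ℕ.+ q * m))
      ≡⟨ cong (nth (B x ++ concatMap B u))
              (trans (+-left-comm r m (q * m)) (cong (ℕ._+ (r ℕ.+ q * m)) (sym (length-B x)))) ⟩
    nth (B x ++ concatMap B u) (length (B x) ℕ.+ (r ℕ.+ q * m))
      ≡⟨ nth-++ʳ (B x) (concatMap B u) (r ℕ.+ q * m) ⟩
    nth (concatMap B u) (r ℕ.+ q * m)
      ≡⟨ nth-concatMap u q r<m ⟩
    nth (map (λ x → nth (B x) r) u) q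
      ∎

length-⊗ : ∀ u w → length (u ⊗ w) ≡ length u * length w
length-⊗ u w = length-concatMap (λ x → scale x w) (λ x → length-map (x ·_) w) u

nth-⊗ : ∀ u w {m} → length w ≡ m → ∀ q {r} → r < m → nth (u ⊗ w) (r ℕ.+ q * m) ≡ nth u q · nth w r
nth-⊗ u w length-w q {r} r<m = begin
  nth (u ⊗ w) (r ℕ.+ q * _)
    ≡⟨ nth-concatMap (λ x → scale x w) (λ x → trans (length-map (x ·_) w) length-w) u q r<m ⟩
  nth (map (λ x → nth (scale x w) r) u) q  ≡⟨ cong (λ v → nth v q) (map-cong (λ x → nth-scale x w r) u) ⟩
  nth (map (_· nth w r) u) q               ≡⟨ nth-map-·ʳ u (nth w r) q ⟩
  nth u q · nth w r                        ∎

length-⊕ : ∀ u v → length u ≡ length v → length (u ⊕ v) ≡ length u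
length-⊕ []      []      _  = refl
length-⊕ (x ∷ u) (y ∷ v) eq = cong suc (length-⊕ u v (ℕ.suc-injective eq))

nth-⊕ : ∀ u v → length u ≡ length v → ∀ c → nth (u ⊕ v) c ≡ nth u c + nth v c
nth-⊕ []      []      _  c       = refl
nth-⊕ (x ∷ u) (y ∷ v) _  zero    = refl
nth-⊕ (x ∷ u) (y ∷ v) eq (suc c) = nth-⊕ u v (ℕ.suc-injective eq) c

‖⊖‖²-coordinates : ∀ d u v → length u ≡ d → length v ≡ d →
                   ‖ u ⊖ v ‖² ≡ ∑[ c < d ] (nth u c - nth v c) ²
‖⊖‖²-coordinates zero    []      []      _  _  = refl
‖⊖‖²-coordinates (suc d) (x ∷ u) (y ∷ v) lu lv =
  cong ((x - y) ² +_) (‖⊖‖²-coordinates d u v (ℕ.suc-injective lu) (ℕ.suc-injective lv))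

module _ (d : ℕ) where

  length-vsum : ∀ {C} → All (λ p → length p ≡ d) C → length (vsum d C) ≡ d
  length-vsum         []        = length-replicate d
  length-vsum {p ∷ C} (lp ∷ lC) = trans (length-⊕ p (vsum d C) (trans lp (sym (length-vsum lC)))) lp

  nth-vsum : ∀ {C} → All (λ p → length p ≡ d) C → ∀ c → nth (vsum d C) c ≡ ∑[ p ∈ C ] nth p c
  nth-vsum         []        c = nth-replicate-0ℚ d c
  nth-vsum {p ∷ C} (lp ∷ lC) c =
    trans (nth-⊕ p (vsum d C) (trans lp (sym (length-vsum lC))) c) (cong (nth p c +_) (nth-vsum lC c))

  nth-μ : ∀ {C} → All (λ p → length p ≡ d) C → ∀ c →
          nth (μ d C) c ≡ inv (length C) · (∑[ p ∈ C ] nth p c)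
  nth-μ {C} lC c = trans (nth-scale (inv (length C)) (vsum d C) c) (cong (inv (length C) ·_) (nth-vsum lC c))

  cost-coordinatewise : ∀ {C} → All (λ p → length p ≡ d) C →
                        cost d C ≡ ∑[ c < d ] ∑[ p ∈ C ] (nth p c - nth (μ d C) c) ²
  cost-coordinatewise {C} lC = begin
    ∑[ p ∈ C ] ‖ p ⊖ μ d C ‖²
      ≡⟨ ∑∈-cong lC (λ p lp → ‖⊖‖²-coordinates d p (μ d C) lp length-μ) ⟩
    ∑[ p ∈ C ] ∑[ c < d ] (nth p c - nth (μ d C) c) ²
      ≡⟨ ∑∈-∑-comm C d (λ p c → (nth p c - nth (μ d C) c) ²) ⟩
    ∑[ c < d ] ∑[ p ∈ C ] (nth p c - nth (μ d C) c) ²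
      ∎
    where
    length-μ : length (μ d C) ≡ d
    length-μ = trans (length-map _ (vsum d C)) (length-vsum lC)

-- Base-k digits

module Digits (k : ℕ) .{{_ : NonZero k}} where

  ⌊_/k^_⌋ : ℕ → ℕ → ℕ
  ⌊ i /k^ a ⌋ = (i / k ^ a) {{ℕ.m^n≢0 k a}}

  ⌊/k^⌋-suc : ∀ i a → ⌊ i /k^ suc a ⌋ ≡ ⌊ i / k /k^ a ⌋
  ⌊/k^⌋-suc i a = sym (m/n/o≡m/[n*o] i k (k ^ a))
    where instance _ = ℕ.m^n≢0 k a
                   _ = ℕ.m^n≢0 k (suc a)

  digit : ℕ → ℕ → ℕ
  digit a i = ⌊ i /k^ a ⌋ % k

  digit<k : ∀ a i → digit a i < k
  digit<k a i = m%n<n ⌊ i /k^ a ⌋ k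

  digit-zero : ∀ i → digit 0 i ≡ i % k
  digit-zero i = cong (_% k) (n/1≡n i)

  digit-suc : ∀ a i → digit (suc a) i ≡ digit a (i / k)
  digit-suc a i = cong (_% k) (⌊/k^⌋-suc i a)

  ∑-%-/ : ∀ α (φ ψ : ℕ → ℚ) →
          ∑[ i < k ^ suc α ] (φ (i % k) · ψ (i / k)) ≡ (∑[ r < k ] φ r) · (∑[ q < k ^ α ] ψ q)
  ∑-%-/ α φ ψ = begin
    ∑[ i < k ^ suc α ] (φ (i % k) · ψ (i / k))
      ≡⟨ cong (λ n → ∑[ i < n ] (φ (i % k) · ψ (i / k))) (ℕ.*-comm k (k ^ α)) ⟩
    ∑[ i < k ^ α * k ] (φ (i % k) · ψ (i / k))
      ≡⟨ ∑-blocks (k ^ α) k _ ⟩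
    ∑[ q < k ^ α ] ∑[ r < k ] (φ ((r ℕ.+ q * k) % k) · ψ ((r ℕ.+ q * k) / k))
      ≡⟨ ∑-cong (k ^ α) (λ q _ → ∑-cong k (λ r r<k →
           cong₂ (λ x y → φ x · ψ y) (%-eq {q = q} r<k) (/-eq r<k))) ⟩
    ∑[ q < k ^ α ] ∑[ r < k ] (φ r · ψ q)
      ≡⟨ ∑-cong (k ^ α) (λ q _ → *-distribʳ-∑ k (ψ q) φ) ⟨
    ∑[ q < k ^ α ] ((∑[ r < k ] φ r) · ψ q)
      ≡⟨ *-distribˡ-∑ (k ^ α) (∑[ r < k ] φ r) ψ ⟨
    (∑[ r < k ] φ r) · (∑[ q < k ^ α ] ψ q)
      ∎
    where
    %-eq : ∀ {r q} → r < k → (r ℕ.+ q * k) % k ≡ r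
    %-eq {r} {q} r<k = trans (%-remove-+ʳ r (n∣m*n q {k})) (m<n⇒m%n≡m r<k)
    /-eq : ∀ {r q} → r < k → (r ℕ.+ q * k) / k ≡ q
    /-eq {r} {q} r<k = trans (+-distrib-/-∣ʳ r (n∣m*n q {k})) (cong₂ ℕ._+_ (m<n⇒m/n≡0 r<k) (m*n/n≡m q k))

  ∑-digit : ∀ α {a} → a < α → (φ : ℕ → ℚ) →
            ∑[ i < k ^ α ] φ (digit a i) ≡ ℕ→ℚ (k ^ (α ∸ 1)) · (∑[ x < k ] φ x)
  ∑-digit (suc α) {zero} _ φ = begin
    ∑[ i < k ^ suc α ] φ (digit 0 i)
      ≡⟨ ∑-cong (k ^ suc α) (λ i _ → trans (cong φ (digit-zero i)) (sym (*-identityʳ _))) ⟩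
    ∑[ i < k ^ suc α ] (φ (i % k) · 1ℚ)     ≡⟨ ∑-%-/ α φ (λ _ → 1ℚ) ⟩
    (∑[ x < k ] φ x) · (∑[ q < k ^ α ] 1ℚ)  ≡⟨ cong ((∑[ x < k ] φ x) ·_) (∑-1 (k ^ α)) ⟩
    (∑[ x < k ] φ x) · ℕ→ℚ (k ^ α)          ≡⟨ *-comm (∑[ x < k ] φ x) (ℕ→ℚ (k ^ α)) ⟩
    ℕ→ℚ (k ^ α) · (∑[ x < k ] φ x)          ∎
  ∑-digit (suc (suc α)) {suc a} (s≤s a<α) φ = begin
    ∑[ i < k ^ suc (suc α) ] φ (digit (suc a) i)
      ≡⟨ ∑-cong (k ^ suc (suc α)) (λ i _ → trans (cong φ (digit-suc a i)) (sym (*-identityˡ _))) ⟩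
    ∑[ i < k ^ suc (suc α) ] (1ℚ · φ (digit a (i / k)))
      ≡⟨ ∑-%-/ (suc α) (λ _ → 1ℚ) (λ q → φ (digit a q)) ⟩
    (∑[ r < k ] 1ℚ) · (∑[ q < k ^ suc α ] φ (digit a q))
      ≡⟨ cong₂ _·_ (∑-1 k) (∑-digit (suc α) a<α φ) ⟩
    ℕ→ℚ k · (ℕ→ℚ (k ^ α) · (∑[ x < k ] φ x))
      ≡⟨ *-assoc (ℕ→ℚ k) (ℕ→ℚ (k ^ α)) (∑[ x < k ] φ x) ⟨
    ℕ→ℚ k · ℕ→ℚ (k ^ α) · (∑[ x < k ] φ x)
      ≡⟨ cong (_· (∑[ x < k ] φ x)) (ℕ→ℚ-* k (k ^ α)) ⟨
    ℕ→ℚ (k ^ suc α) · (∑[ x < k ] φ x)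
      ∎
  ∑-digit (suc zero) {suc a} (s≤s ()) φ

  ∑-digits-zero-suc : ∀ α {a} → a < α → (φ ψ : ℕ → ℚ) →
    ∑[ i < k ^ suc α ] (φ (digit 0 i) · ψ (digit (suc a) i)) ≡
    ℕ→ℚ (k ^ (α ∸ 1)) · ((∑[ x < k ] φ x) · (∑[ x < k ] ψ x))
  ∑-digits-zero-suc α {a} a<α φ ψ = begin
    ∑[ i < k ^ suc α ] (φ (digit 0 i) · ψ (digit (suc a) i))
      ≡⟨ ∑-cong (k ^ suc α) (λ i _ → cong₂ (λ x y → φ x · ψ y) (digit-zero i) (digit-suc a i)) ⟩
    ∑[ i < k ^ suc α ] (φ (i % k) · ψ (digit a (i / k)))  ≡⟨ ∑-%-/ α φ (λ q → ψ (digit a q)) ⟩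
    Σφ · (∑[ q < k ^ α ] ψ (digit a q))                   ≡⟨ cong (Σφ ·_) (∑-digit α a<α ψ) ⟩
    Σφ · (ℕ→ℚ (k ^ (α ∸ 1)) · Σψ)                         ≡⟨ *-left-comm Σφ (ℕ→ℚ (k ^ (α ∸ 1))) Σψ ⟩
    ℕ→ℚ (k ^ (α ∸ 1)) · (Σφ · Σψ)                         ∎
    where
    Σφ = ∑[ x < k ] φ x
    Σψ = ∑[ x < k ] ψ x

  ∑-two-digits : ∀ α {a a'} → a < α → a' < α → a ≢ a' → (φ ψ : ℕ → ℚ) →
    ∑[ i < k ^ α ] (φ (digit a i) · ψ (digit a' i)) ≡
    ℕ→ℚ (k ^ (α ∸ 2)) · ((∑[ x < k ] φ x) · (∑[ x < k ] ψ x))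
  ∑-two-digits (suc α) {zero} {zero} _ _ a≢a' φ ψ = ⊥-elim (a≢a' refl)
  ∑-two-digits (suc α) {zero} {suc a'} _ (s≤s a'<α) _ φ ψ = ∑-digits-zero-suc α a'<α φ ψ
  ∑-two-digits (suc α) {suc a} {zero} (s≤s a<α) _ _ φ ψ = begin
    ∑[ i < k ^ suc α ] (φ (digit (suc a) i) · ψ (digit 0 i))
      ≡⟨ ∑-cong (k ^ suc α) (λ i _ → *-comm (φ (digit (suc a) i)) (ψ (digit 0 i))) ⟩
    ∑[ i < k ^ suc α ] (ψ (digit 0 i) · φ (digit (suc a) i))
      ≡⟨ ∑-digits-zero-suc α a<α ψ φ ⟩
    ℕ→ℚ (k ^ (α ∸ 1)) · (Σψ · Σφ)
      ≡⟨ cong (ℕ→ℚ (k ^ (α ∸ 1)) ·_) (*-comm Σψ Σφ) ⟩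
    ℕ→ℚ (k ^ (α ∸ 1)) · (Σφ · Σψ)
      ∎
    where
    Σφ = ∑[ x < k ] φ x
    Σψ = ∑[ x < k ] ψ x
  ∑-two-digits (suc (suc (suc α))) {suc a} {suc a'} (s≤s a<α) (s≤s a'<α) a≢a' φ ψ = begin
    ∑[ i < k ^ suc (suc (suc α)) ] (φ (digit (suc a) i) · ψ (digit (suc a') i))
      ≡⟨ ∑-cong (k ^ suc (suc (suc α)))
                (λ i _ → trans (cong₂ (λ x y → φ x · ψ y) (digit-suc a i) (digit-suc a' i))
                               (sym (*-identityˡ _))) ⟩
    ∑[ i < k ^ suc (suc (suc α)) ] (1ℚ · (φ (digit a (i / k)) · ψ (digit a' (i / k))))
      ≡⟨ ∑-%-/ (suc (suc α)) (λ _ → 1ℚ) (λ q → φ (digit a q) · ψ (digit a' q)) ⟩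
    (∑[ r < k ] 1ℚ) · (∑[ q < k ^ suc (suc α) ] (φ (digit a q) · ψ (digit a' q)))
      ≡⟨ cong₂ _·_ (∑-1 k) (∑-two-digits (suc (suc α)) a<α a'<α (λ eq → a≢a' (cong suc eq)) φ ψ) ⟩
    ℕ→ℚ k · (ℕ→ℚ (k ^ α) · (Σφ · Σψ))
      ≡⟨ *-assoc (ℕ→ℚ k) (ℕ→ℚ (k ^ α)) (Σφ · Σψ) ⟨
    ℕ→ℚ k · ℕ→ℚ (k ^ α) · (Σφ · Σψ)
      ≡⟨ cong (_· (Σφ · Σψ)) (ℕ→ℚ-* k (k ^ α)) ⟨
    ℕ→ℚ (k ^ suc α) · (Σφ · Σψ)
      ∎
    where
    Σφ = ∑[ x < k ] φ x
    Σψ = ∑[ x < k ] ψ x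
  ∑-two-digits (suc (suc zero)) {suc zero}    {suc zero}     _ _ a≢a' φ ψ = ⊥-elim (a≢a' refl)
  ∑-two-digits (suc (suc zero)) {suc (suc a)} (s≤s (s≤s ())) _ _ φ ψ
  ∑-two-digits (suc (suc zero)) {suc zero}    {suc (suc a')} _ (s≤s (s≤s ())) _ φ ψ
  ∑-two-digits (suc zero)       {suc a}       (s≤s ()) _ _ φ ψ

-- The benchmark matrix

module Benchmark (k : ℕ) .{{_ : NonZero k}} where
  open Digits k

  entry : ℕ → ℕ → ℚ
  entry x b = δ x b - inv k

  nth-v1 : ∀ b {x} → x < k → nth (v1 k (suc b)) x ≡ entry x b
  nth-v1 b x<k = trans (cong (λ v → nth v _) (map-upTo _ k)) (nth-applyUpTo _ x<k)

  length-vℓ : ∀ b a → length (vℓ k b a) ≡ k ^ suc a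
  length-vℓ b zero    = trans (trans (length-map _ (upTo k)) (length-upTo k)) (sym (ℕ.*-identityʳ k))
  length-vℓ b (suc a) = begin
    length (vℓ k b a ⊗ 𝟙 k)           ≡⟨ length-⊗ (vℓ k b a) (𝟙 k) ⟩
    length (vℓ k b a) * length (𝟙 k)  ≡⟨ cong₂ _*_ (length-vℓ b a) (length-replicate k) ⟩
    k ^ suc a * k                     ≡⟨ ℕ.*-comm (k ^ suc a) k ⟩
    k ^ suc (suc a)                   ∎

  nth-vℓ : ∀ b a i → nth (vℓ k b a) i ≡ nth (v1 k b) ⌊ i /k^ a ⌋
  nth-vℓ b zero    i = cong (nth (v1 k b)) (sym (n/1≡n i))
  nth-vℓ b (suc a) i = begin
    nth (vℓ k b a ⊗ 𝟙 k) i
      ≡⟨ cong (nth (vℓ k b a ⊗ 𝟙 k)) (m≡m%n+[m/n]*n i k) ⟩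
    nth (vℓ k b a ⊗ 𝟙 k) (i % k ℕ.+ i / k * k)
      ≡⟨ nth-⊗ (vℓ k b a) (𝟙 k) (length-replicate k) (i / k) (m%n<n i k) ⟩
    nth (vℓ k b a) (i / k) · nth (𝟙 k) (i % k)  ≡⟨ cong (nth (vℓ k b a) (i / k) ·_) (nth-𝟙 (m%n<n i k)) ⟩
    nth (vℓ k b a) (i / k) · 1ℚ                 ≡⟨ *-identityʳ _ ⟩
    nth (vℓ k b a) (i / k)                      ≡⟨ nth-vℓ b a (i / k) ⟩
    nth (v1 k b) ⌊ i / k /k^ a ⌋                ≡⟨ cong (nth (v1 k b)) (⌊/k^⌋-suc i a) ⟨
    nth (v1 k b) ⌊ i /k^ suc a ⌋                ∎

  nth-column : ∀ {α a} b {i} → a < α → i < k ^ α → nth (column k α a b) i ≡ nth (v1 k b) (digit a i)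
  nth-column {α} {a} b {i} a<α i<k^α = begin
    nth (𝟙 N ⊗ vℓ k b a) i
      ≡⟨ cong (nth (𝟙 N ⊗ vℓ k b a)) (m≡m%n+[m/n]*n i M) ⟩
    nth (𝟙 N ⊗ vℓ k b a) (i % M ℕ.+ i / M * M)
      ≡⟨ nth-⊗ (𝟙 N) (vℓ k b a) (length-vℓ b a) (i / M) (m%n<n i M) ⟩
    nth (𝟙 N) (i / M) · nth (vℓ k b a) (i % M)
      ≡⟨ cong₂ _·_ (nth-𝟙 (m<n*o⇒m/o<n {n = N} {o = M} i<N*M)) (nth-vℓ b a (i % M)) ⟩
    1ℚ · nth (v1 k b) ⌊ i % M /k^ a ⌋           ≡⟨ *-identityˡ _ ⟩
    nth (v1 k b) ⌊ i % M /k^ a ⌋                ≡⟨ cong (nth (v1 k b)) (m%[n*o]/o≡m/o%n i k (k ^ a)) ⟩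
    nth (v1 k b) (digit a i)                    ∎
    where
    instance _ = ℕ.m^n≢0 k a
             _ = ℕ.m^n≢0 k (suc a)
    N M : ℕ
    N = k ^ (α ∸ a ∸ 1)
    M = k ^ suc a
    exponents : α ∸ a ∸ 1 ℕ.+ suc a ≡ α
    exponents = trans (cong (ℕ._+ suc a) (trans (ℕ.∸-+-assoc α a 1) (cong (α ∸_) (ℕ.+-comm a 1))))
                      (ℕ.m∸n+n≡m a<α)
    i<N*M : i < N * M
    i<N*M = subst (i <_) (trans (cong (k ^_) (sym exponents)) (ℕ.^-distribˡ-+-* k (α ∸ a ∸ 1) (suc a))) i<k^α

  row : ℕ → ℕ → List ℚ
  row α i = map (λ col → nth col i) (columns k α)

  block : ℕ → ℕ → ℕ → List ℚ
  block α i a = applyUpTo (λ b → nth (column k α a (suc b)) i) k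

  length-block : ∀ α i a → length (block α i a) ≡ k
  length-block α i a = length-applyUpTo _ k

  row-blocks : ∀ α i → row α i ≡ concatMap (block α i) (upTo α)
  row-blocks α i = trans (map-concatMap h (λ a → map (λ b → column k α a (suc b)) (upTo k)) (upTo α))
                         (concatMap-cong (λ a → trans (cong (map h) (map-upTo _ k)) (map-applyUpTo _ h k)) (upTo α))
    where
    h : List ℚ → ℚ
    h col = nth col i

  length-row : ∀ α i → length (row α i) ≡ α * k
  length-row α i = begin
    length (row α i)                         ≡⟨ cong length (row-blocks α i) ⟩
    length (concatMap (block α i) (upTo α))  ≡⟨ length-concatMap (block α i) (length-block α i) (upTo α) ⟩
    length (upTo α) * k                      ≡⟨ cong (_* k) (length-upTo α) ⟩
    α * k                                    ∎

  nth-row : ∀ {α a b i} → a < α → b < k → i < k ^ α → nth (row α i) (b ℕ.+ a * k) ≡ entry (digit a i) b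
  nth-row {α} {a} {b} {i} a<α b<k i<k^α = begin
    nth (row α i) (b ℕ.+ a * k)
      ≡⟨ cong (λ r → nth r (b ℕ.+ a * k)) (row-blocks α i) ⟩
    nth (concatMap (block α i) (upTo α)) (b ℕ.+ a * k)
      ≡⟨ nth-concatMap (block α i) (length-block α i) (upTo α) a b<k ⟩
    nth (map (λ a → nth (block α i a) b) (upTo α)) a      ≡⟨ cong (λ v → nth v a) (map-upTo _ α) ⟩
    nth (applyUpTo (λ a → nth (block α i a) b) α) a       ≡⟨ nth-applyUpTo _ a<α ⟩
    nth (block α i a) b                                   ≡⟨ nth-applyUpTo _ b<k ⟩
    nth (column k α a (suc b)) i                          ≡⟨ nth-column (suc b) a<α i<k^α ⟩
    nth (v1 k (suc b)) (digit a i)                        ≡⟨ nth-v1 b (digit<k a i) ⟩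
    entry (digit a i) b                                   ∎

-- The cluster

-- Here j is 0-based: the module describes the cluster that Defs calls cluster k α a (suc j).
module Cluster (k α a j : ℕ) (1<k : 1 < k) (a<α : a < α) (j<k : j < k) where
  private instance
    k≢0 : NonZero k
    k≢0 = ℕ.>-nonZero (ℕ.<-trans (s≤s z≤n) 1<k)
  open Digits k
  open Benchmark k

  C : List (List ℚ)
  C = cluster k α a (suc j)

  μC : List ℚ
  μC = μ (α * k) C

  selected : List ℚ → Bool
  selected p = does (0ℚ <? nth p (a * k ℕ.+ j))

  selected-row : ∀ {i} → i < k ^ α → selected (row α i) ≡ (digit a i ≡ᵇ j)
  selected-row {i} i<k^α = begin
    does (0ℚ <? nth (row α i) (a * k ℕ.+ j))
      ≡⟨ cong (λ c → does (0ℚ <? nth (row α i) c)) (ℕ.+-comm (a * k) j) ⟩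
    does (0ℚ <? nth (row α i) (j ℕ.+ a * k))
      ≡⟨ cong (λ x → does (0ℚ <? x)) (nth-row a<α j<k i<k^α) ⟩
    does (0ℚ <? entry (digit a i) j)
      ≡⟨ entry-sign k 1<k (digit a i ≡ᵇ j) ⟩
    (digit a i ≡ᵇ j)
      ∎

  ∑-cluster : ∀ (g : List ℚ → ℚ) → ∑[ p ∈ C ] g p ≡ ∑[ i < k ^ α ] (δ (digit a i) j · g (row α i))
  ∑-cluster g = begin
    ∑[ p ∈ C ] g p
      ≡⟨ ∑∈-filter (λ p → 0ℚ <? nth p (a * k ℕ.+ j)) (rows k α) g ⟩
    ∑[ p ∈ map (row α) (upTo (k ^ α)) ] (if selected p then g p else 0ℚ)
      ≡⟨ cong (λ ps → ∑[ p ∈ ps ] (if selected p then g p else 0ℚ)) (map-upTo (row α) (k ^ α)) ⟩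
    ∑[ p ∈ applyUpTo (row α) (k ^ α) ] (if selected p then g p else 0ℚ)
      ≡⟨ ∑∈-applyUpTo (row α) (k ^ α) (λ p → if selected p then g p else 0ℚ) ⟩
    ∑[ i < k ^ α ] (if selected (row α i) then g (row α i) else 0ℚ)
      ≡⟨ ∑-cong (k ^ α) (λ i i<k^α → trans (cong (λ b → if b then g (row α i) else 0ℚ) (selected-row i<k^α))
                                           (if-then-else-0 (digit a i ≡ᵇ j) (g (row α i)))) ⟩
    ∑[ i < k ^ α ] (δ (digit a i) j · g (row α i))
      ∎

  ∑-cluster-coordinate : ∀ {a' b} (F : ℚ → ℚ) → a' < α → b < k →
    ∑[ p ∈ C ] F (nth p (b ℕ.+ a' * k)) ≡ ∑[ i < k ^ α ] (δ (digit a i) j · F (entry (digit a' i) b))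
  ∑-cluster-coordinate {a'} {b} F a'<α b<k =
    trans (∑-cluster (λ p → F (nth p (b ℕ.+ a' * k))))
          (∑-cong (k ^ α) (λ i i<k^α → cong (λ x → δ (digit a i) j · F x) (nth-row a'<α b<k i<k^α)))

  ∑-δ-own-digit : ∀ (φ : ℕ → ℚ) →
                  ∑[ i < k ^ α ] (δ (digit a i) j · φ (digit a i)) ≡ ℕ→ℚ (k ^ (α ∸ 1)) · φ j
  ∑-δ-own-digit φ =
    trans (∑-digit α a<α (λ x → δ x j · φ x)) (cong (ℕ→ℚ (k ^ (α ∸ 1)) ·_) (∑-δ k j φ j<k))

  ∑-δ-other-digit : ∀ {a'} → a' < α → a' ≢ a → (ψ : ℕ → ℚ) →
                    ∑[ i < k ^ α ] (δ (digit a i) j · ψ (digit a' i)) ≡ ℕ→ℚ (k ^ (α ∸ 2)) · (∑[ x < k ] ψ x)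
  ∑-δ-other-digit {a'} a'<α a'≢a ψ = begin
    ∑[ i < k ^ α ] (δ (digit a i) j · ψ (digit a' i))
      ≡⟨ ∑-two-digits α a<α a'<α (λ eq → a'≢a (sym eq)) (λ x → δ x j) ψ ⟩
    ℕ→ℚ (k ^ (α ∸ 2)) · ((∑[ x < k ] δ x j) · Σψ)
      ≡⟨ cong (λ s → ℕ→ℚ (k ^ (α ∸ 2)) · (s · Σψ)) ∑δ≡1 ⟩
    ℕ→ℚ (k ^ (α ∸ 2)) · (1ℚ · Σψ)
      ≡⟨ cong (ℕ→ℚ (k ^ (α ∸ 2)) ·_) (*-identityˡ Σψ) ⟩
    ℕ→ℚ (k ^ (α ∸ 2)) · Σψ
      ∎
    where
    Σψ = ∑[ x < k ] ψ x
    ∑δ≡1 : ∑[ x < k ] δ x j ≡ 1ℚ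
    ∑δ≡1 = trans (∑-cong k (λ x _ → sym (*-identityʳ (δ x j)))) (∑-δ k j (λ _ → 1ℚ) j<k)

  rows-length : All (λ p → length p ≡ α * k) C
  rows-length =
    filter⁺ (λ p → 0ℚ <? nth p (a * k ℕ.+ j)) (map⁺ (applyUpTo⁺₂ (λ i → i) (k ^ α) (length-row α)))

  cluster-size : length C ≡ k ^ (α ∸ 1)
  cluster-size = ℕ→ℚ-injective (begin
    ℕ→ℚ (length C)                          ≡⟨ length-∑∈ C ⟩
    ∑[ p ∈ C ] 1ℚ                           ≡⟨ ∑-cluster (λ _ → 1ℚ) ⟩
    ∑[ i < k ^ α ] (δ (digit a i) j · 1ℚ)   ≡⟨ ∑-δ-own-digit (λ _ → 1ℚ) ⟩
    ℕ→ℚ (k ^ (α ∸ 1)) · 1ℚ                  ≡⟨ *-identityʳ (ℕ→ℚ (k ^ (α ∸ 1))) ⟩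
    ℕ→ℚ (k ^ (α ∸ 1))                       ∎)

  inv-cluster-size : inv (length C) · ℕ→ℚ (k ^ (α ∸ 1)) ≡ 1ℚ
  inv-cluster-size = trans (cong (λ n → inv n · ℕ→ℚ (k ^ (α ∸ 1))) cluster-size)
                           (inv-inverseˡ (k ^ (α ∸ 1)) {{ℕ.m^n≢0 k (α ∸ 1)}})

  nth-μC : ∀ {a' b} → a' < α → b < k →
           nth μC (b ℕ.+ a' * k) ≡ inv (length C) · (∑[ i < k ^ α ] (δ (digit a i) j · entry (digit a' i) b))
  nth-μC {a'} {b} a'<α b<k = trans (nth-μ (α * k) rows-length (b ℕ.+ a' * k))
                                   (cong (inv (length C) ·_) (∑-cluster-coordinate (λ x → x) a'<α b<k))

  nth-μC-own-block : ∀ {b} → b < k → nth μC (b ℕ.+ a * k) ≡ entry j b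
  nth-μC-own-block {b} b<k = begin
    nth μC (b ℕ.+ a * k)
      ≡⟨ nth-μC a<α b<k ⟩
    inv (length C) · (∑[ i < k ^ α ] (δ (digit a i) j · entry (digit a i) b))
      ≡⟨ cong (inv (length C) ·_) (∑-δ-own-digit (λ x → entry x b)) ⟩
    inv (length C) · (ℕ→ℚ (k ^ (α ∸ 1)) · entry j b)
      ≡⟨ *-assoc (inv (length C)) (ℕ→ℚ (k ^ (α ∸ 1))) (entry j b) ⟨
    inv (length C) · ℕ→ℚ (k ^ (α ∸ 1)) · entry j b
      ≡⟨ cong (_· entry j b) inv-cluster-size ⟩
    1ℚ · entry j b
      ≡⟨ *-identityˡ (entry j b) ⟩
    entry j b
      ∎

  nth-μC-other-block : ∀ {a' b} → a' < α → a' ≢ a → b < k → nth μC (b ℕ.+ a' * k) ≡ 0ℚ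
  nth-μC-other-block {a'} {b} a'<α a'≢a b<k = begin
    nth μC (b ℕ.+ a' * k)
      ≡⟨ nth-μC a'<α b<k ⟩
    inv (length C) · (∑[ i < k ^ α ] (δ (digit a i) j · entry (digit a' i) b))
      ≡⟨ cong (inv (length C) ·_) (∑-δ-other-digit a'<α a'≢a (λ x → entry x b)) ⟩
    inv (length C) · (ℕ→ℚ (k ^ (α ∸ 2)) · (∑[ x < k ] entry x b))
      ≡⟨ cong (λ s → inv (length C) · (ℕ→ℚ (k ^ (α ∸ 2)) · s)) (∑-entry b<k) ⟩
    inv (length C) · (ℕ→ℚ (k ^ (α ∸ 2)) · 0ℚ)
      ≡⟨ cong (inv (length C) ·_) (*-zeroʳ (ℕ→ℚ (k ^ (α ∸ 2)))) ⟩
    inv (length C) · 0ℚ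
      ≡⟨ *-zeroʳ (inv (length C)) ⟩
    0ℚ
      ∎

  coordinate-cost : ℕ → ℚ
  coordinate-cost c = ∑[ p ∈ C ] (nth p c - nth μC c) ²

  coordinate-cost-own-block : ∀ {b} → b < k → coordinate-cost (b ℕ.+ a * k) ≡ 0ℚ
  coordinate-cost-own-block {b} b<k = begin
    ∑[ p ∈ C ] (nth p c - nth μC c) ²
      ≡⟨ cong (λ m → ∑[ p ∈ C ] (nth p c - m) ²) (nth-μC-own-block b<k) ⟩
    ∑[ p ∈ C ] (nth p c - entry j b) ²
      ≡⟨ ∑-cluster-coordinate (λ x → (x - entry j b) ²) a<α b<k ⟩
    ∑[ i < k ^ α ] (δ (digit a i) j · (entry (digit a i) b - entry j b) ²)
      ≡⟨ ∑-δ-own-digit (λ x → (entry x b - entry j b) ²) ⟩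
    ℕ→ℚ (k ^ (α ∸ 1)) · (entry j b - entry j b) ²
      ≡⟨ cong (λ x → ℕ→ℚ (k ^ (α ∸ 1)) · x ²) (+-inverseʳ (entry j b)) ⟩
    ℕ→ℚ (k ^ (α ∸ 1)) · 0ℚ
      ≡⟨ *-zeroʳ (ℕ→ℚ (k ^ (α ∸ 1))) ⟩
    0ℚ
      ∎
    where
    c = b ℕ.+ a * k

  coordinate-cost-other-block : ∀ {a' b} → a' < α → a' ≢ a → b < k →
                                coordinate-cost (b ℕ.+ a' * k) ≡ ℕ→ℚ (k ^ (α ∸ 2)) · (ℕ→ℚ (k ∸ 1) · inv k)
  coordinate-cost-other-block {a'} {b} a'<α a'≢a b<k = begin
    ∑[ p ∈ C ] (nth p c - nth μC c) ²
      ≡⟨ cong (λ m → ∑[ p ∈ C ] (nth p c - m) ²) (nth-μC-other-block a'<α a'≢a b<k) ⟩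
    ∑[ p ∈ C ] (nth p c - 0ℚ) ²
      ≡⟨ ∑-cluster-coordinate (λ x → (x - 0ℚ) ²) a'<α b<k ⟩
    ∑[ i < k ^ α ] (δ (digit a i) j · (entry (digit a' i) b - 0ℚ) ²)
      ≡⟨ ∑-δ-other-digit a'<α a'≢a (λ x → (entry x b - 0ℚ) ²) ⟩
    ℕ→ℚ (k ^ (α ∸ 2)) · (∑[ x < k ] (entry x b - 0ℚ) ²)
      ≡⟨ cong (ℕ→ℚ (k ^ (α ∸ 2)) ·_) (∑-cong k (λ x _ → cong _² (+-identityʳ (entry x b)))) ⟩
    ℕ→ℚ (k ^ (α ∸ 2)) · (∑[ x < k ] entry x b ²)
      ≡⟨ cong (ℕ→ℚ (k ^ (α ∸ 2)) ·_) (∑-entry² b<k) ⟩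
    ℕ→ℚ (k ^ (α ∸ 2)) · (ℕ→ℚ (k ∸ 1) · inv k)
      ∎
    where
    c = b ℕ.+ a' * k

  cost-cluster : cost (α * k) C ≡ ℕ→ℚ ((α ∸ 1) * k ^ (α ∸ 2) * (k ∸ 1))
  cost-cluster = begin
    cost (α * k) C                         ≡⟨ cost-coordinatewise (α * k) rows-length ⟩
    ∑[ c < α * k ] coordinate-cost c       ≡⟨ ∑-blocks α k coordinate-cost ⟩
    ∑[ a' < α ] block-cost a'              ≡⟨ ∑-const-except α a (K · V) block-cost a<α other-blocks ⟩
    block-cost a + A · (K · V)             ≡⟨ cong (_+ A · (K · V)) own-block ⟩
    0ℚ + A · (K · (P · (K₁ · inv k)))      ≡⟨ cancel-k (inv-inverseˡ k) ⟩
    A · P · K₁                             ≡⟨ cong (_· K₁) (ℕ→ℚ-* (α ∸ 1) (k ^ (α ∸ 2))) ⟨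
    ℕ→ℚ ((α ∸ 1) * k ^ (α ∸ 2)) · K₁       ≡⟨ ℕ→ℚ-* ((α ∸ 1) * k ^ (α ∸ 2)) (k ∸ 1) ⟨
    ℕ→ℚ ((α ∸ 1) * k ^ (α ∸ 2) * (k ∸ 1))  ∎
    where
    A = ℕ→ℚ (α ∸ 1)
    K = ℕ→ℚ k
    P = ℕ→ℚ (k ^ (α ∸ 2))
    K₁ = ℕ→ℚ (k ∸ 1)
    V = P · (K₁ · inv k)
    block-cost : ℕ → ℚ
    block-cost a' = ∑[ b < k ] coordinate-cost (b ℕ.+ a' * k)
    own-block : block-cost a ≡ 0ℚ
    own-block = trans (∑-cong k (λ b b<k → coordinate-cost-own-block b<k)) (trans (∑-const k 0ℚ) (*-zeroʳ K))
    other-blocks : ∀ a' → a' < α → a' ≢ a → block-cost a' ≡ K · V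
    other-blocks a' a'<α a'≢a =
      trans (∑-cong k (λ b b<k → coordinate-cost-other-block a'<α a'≢a b<k)) (∑-const k V)
    cancel-k : inv k · K ≡ 1ℚ → 0ℚ + A · (K · (P · (K₁ · inv k))) ≡ A · P · K₁
    cancel-k uK≡1 = begin
      0ℚ + A · (K · (P · (K₁ · inv k)))  ≡⟨ rearrange A K P K₁ (inv k) ⟩
      A · P · K₁ · (inv k · K)           ≡⟨ cong (A · P · K₁ ·_) uK≡1 ⟩
      A · P · K₁ · 1ℚ                    ≡⟨ *-identityʳ (A · P · K₁) ⟩
      A · P · K₁                         ∎
      where
      rearrange : ∀ A K P K₁ u → 0ℚ + A · (K · (P · (K₁ · u))) ≡ A · P · K₁ · (u · K)
      rearrange = solve-∀ ℚ-ring

-- The hypothesis 1 ≤ α is implied by a < α.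
fact2 : (k α : ℕ) → 2 ≤ k → 1 ≤ α →
    (a : ℕ) → a < α → (j : ℕ) → 1 ≤ j → j ≤ k →
    cost (α * k) (cluster k α a j) ≡ ℕ→ℚ ((α ∸ 1) * k ^ (α ∸ 2) * (k ∸ 1))
fact2 k α 2≤k _ a a<α (suc j) _ j≤k = Cluster.cost-cluster k α a j 2≤k a<α j≤k
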